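{- Let $m,n\ge 3$ be odd, coprime integers such that $q=2mn+1$ is a prime power. Then there exists a globally simple Heffter array H$(m,n)$ over $\mathbb{F}_q$.
   Context: A half-set of an additive group $G$ of odd order $2\ell+1$ is an $\ell$-subset $L$ with $L\cup -L=G\setminus\{0\}$. A Heffter array H$(m,n)$ over $\mathbb{F}_q$ is an $m\times n$ matrix over $\mathbb{F}_q$ whose entries form a half-set of the additive group of $\mathbb{F}_q$ and whose every row and column sums to $0$. An H$(m,n)$ $A=(a_{i,j})$ is globally simple if for each row $i$ the partial sums $\sum_{k=1}^j a_{i,k}$ ($1\le j\le n$) are pairwise distinct and for each column $j$ the partial sums $\sum_{k=1}^i a_{k,j}$ ($1\le i\le m$) are pairwise distinct. -}

module Defs where

open import Data.Nat using (ℕ; zero; suc; _^_; _≤_)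
import Data.Nat as ℕ
open import Data.Fin using (Fin; zero; suc)
open import Data.Product using (Σ; ∃; ∃-syntax; _×_; _,_)
open import Data.Sum using (_⊎_)
open import Relation.Nullary using (¬_)
open import Relation.Binary.PropositionalEquality using (_≡_)
open import Algebra.Structures using (IsCommutativeRing)
open import Function.Definitions using (Injective)
open import Data.Nat.Primality using (Prime)

Odd : ℕ → Set
Odd m = ∃[ k ] m ≡ suc (2 ℕ.* k)

IsPrimePower : ℕ → Set
IsPrimePower q = ∃[ p ] ∃[ k ] (Prime p × 1 ≤ k × q ≡ p ^ k)

record Field : Set₁ where
  infixl 7 _*_
  infixl 6 _+_
  field
    Carrier : Set
    _+_ _*_ : Carrier → Carrier → Carrier
    -_      : Carrier → Carrier
    0# 1#   : Carrier
    isCommutativeRing : IsCommutativeRing _≡_ _+_ _*_ -_ 0# 1#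
    0≢1     : ¬ (0# ≡ 1#)
    inverse : ∀ x → ¬ (x ≡ 0#) → ∃[ y ] (x * y ≡ 1#)

module HeffterDefs (F : Field) where
  open Field F

  sumF : (k : ℕ) → (Fin k → Carrier) → Carrier
  sumF zero    f = 0#
  sumF (suc k) f = f zero + sumF k (λ i → f (suc i))

  psum : {k : ℕ} → (Fin k → Carrier) → Fin k → Carrier
  psum f zero    = f zero
  psum f (suc j) = f zero + psum (λ i → f (suc i)) j

  -- The entries of the m×n matrix A form a half-set of (Carrier,+) for a
  -- group of order 2mn+1: they are mn pairwise distinct elements (an
  -- mn-subset L) and L ∪ -L = Carrier ∖ {0}.
  EntriesFormHalfSet : {m n : ℕ} → (Fin m → Fin n → Carrier) → Set
  EntriesFormHalfSet {m} {n} A =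
      (∀ i j i' j' → A i j ≡ A i' j' → (i ≡ i' × j ≡ j'))
    × (∀ i j → ¬ (A i j ≡ 0#))
    × (∀ x → ¬ (x ≡ 0#) → ∃[ i ] ∃[ j ] (A i j ≡ x ⊎ A i j ≡ - x))

  IsHeffter : {m n : ℕ} → (Fin m → Fin n → Carrier) → Set
  IsHeffter {m} {n} A =
      EntriesFormHalfSet A
    × (∀ i → sumF n (λ j → A i j) ≡ 0#)
    × (∀ j → sumF m (λ i → A i j) ≡ 0#)

  IsGloballySimple : {m n : ℕ} → (Fin m → Fin n → Carrier) → Set
  IsGloballySimple {m} {n} A =
      (∀ i → Injective _≡_ _≡_ (psum (λ j → A i j)))
    × (∀ j → Injective _≡_ _≡_ (psum (λ i → A i j)))

-- Take α, β ∈ F of multiplicative orders m and n and put A i j = α ^ i * β ^ j. Such elements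
-- exist for every divisor of |F ∖ {0}| = 2mn: Fermat's little theorem and the fact that
-- X ^ k - 1 has at most k roots give an element of each prime-power order, and elements of
-- coprime orders multiply to one whose order is the product.
-- Every row and column of A is a geometric progression whose ratio has order n (resp. m), so it
-- sums to 0, and its partial sums c (1 + z + ⋯ + z ^ j) are distinct because the z ^ j are.
-- The entries are distinct because (A i j) ^ n = (α ^ n) ^ i with α ^ n again of order m, as
-- m and n are coprime; and A i j ≢ - A i′ j′ because (A i j) ^ (mn) = 1 with mn odd, while
-- 1 + 1 ≢ 0 in a field of odd size. So the 2mn elements ± A i j are distinct and nonzero, and
-- therefore exhaust F ∖ {0}.
module Submission where

open import Data.Nat as ℕ using (ℕ; zero; suc; _≤_; _<_; z≤n; s≤s; NonZero)
open import Data.Product using (∃-syntax; _×_; _,_; proj₁; proj₂; uncurry)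
open import Data.Sum using (_⊎_; inj₁; inj₂)
open import Data.Empty using (⊥-elim)
open import Relation.Nullary using (¬_; yes; no)
open import Relation.Binary.PropositionalEquality
open import Function.Base using (_∘_)
open import Induction.WellFounded using (Acc; acc)
open import Algebra.Bundles using (CommutativeRing; Semiring)
import Data.Nat.Properties as ℕₚ

open import Data.Fin as Fin using (Fin; zero; suc)
import Data.Fin.Properties as FinP
open import Data.Fin.Permutation using (Permutation; permutation)
open import Data.Vec using (Vec; []; _∷_)
open import Function.Definitions using (Injective)
open import Function.Bundles using (_↔_; Inverse; Injection)
open import Function.Properties.Inverse using (↔⇒↣; ↔-sym)
open import Relation.Binary.Definitions using (DecidableEquality)
open import Relation.Nullary.Decidable using (map′)

open import Data.Nat.Coprimality using (Coprime)
open import Defs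

module Arithmetic where
  open import Data.Nat using (_+_; _*_; _^_; nonTrivial⇒n>1)
  open import Data.Nat.Properties
  open import Data.Nat.Divisibility
  open import Data.Nat.Coprimality as Coprimality using (Coprime; coprime-divisor; 1-coprimeTo)
  open import Data.Nat.Primality using (Prime; prime⇒irreducible; prime⇒nonTrivial; prime⇒nonZero)
  open import Data.Nat.Primality.Factorisation using (factorise)
  open import Data.Nat.Induction using (<-wellFounded)
  open import Data.List using ([]; _∷_)
  open import Data.Nat.ListAction using (product)
  open import Data.List.Relation.Unary.All using (_∷_)

  prime∤⇒coprime : ∀ {p r} → Prime p → ¬ p ∣ r → Coprime p r
  prime∤⇒coprime p-prime p∤r (d∣p , d∣r) with prime⇒irreducible p-prime d∣p
  ... | inj₁ d≡1 = d≡1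
  ... | inj₂ refl = ⊥-elim (p∤r d∣r)

  coprime-*ˡ : ∀ {a b c} → Coprime a c → Coprime b c → Coprime (a * b) c
  coprime-*ˡ a⊥c b⊥c {d} (d∣ab , d∣c) = b⊥c (coprime-divisor d⊥a d∣ab , d∣c)
    where
    d⊥a : Coprime d _
    d⊥a (e∣d , e∣a) = a⊥c (e∣a , ∣-trans e∣d d∣c)

  coprime-∣-* : ∀ {d e k} → Coprime d e → d ∣ k → e ∣ k → d * e ∣ k
  coprime-∣-* {d} {e} d⊥e (divides t refl) e∣td =
    subst (d * e ∣_) (*-comm d t) (*-monoʳ-∣ d (coprime-divisor (Coprimality.sym d⊥e) e∣dt))
    where
    e∣dt : e ∣ d * t
    e∣dt = subst (e ∣_) (*-comm t d) e∣td

  prime∤⇒coprime-^ : ∀ {p r} → Prime p → ¬ p ∣ r → ∀ k → Coprime (p ^ k) r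
  prime∤⇒coprime-^ p-prime p∤r zero = 1-coprimeTo _
  prime∤⇒coprime-^ p-prime p∤r (suc k) =
    coprime-*ˡ (prime∤⇒coprime p-prime p∤r) (prime∤⇒coprime-^ p-prime p∤r k)

  ∃-prime-divisor : ∀ d → 1 < d → ∃[ p ] (Prime p × p ∣ d)
  ∃-prime-divisor d@(suc _) 1<d with factorise d
  ... | record { factors = [] ; isFactorisation = d≡1 } = ⊥-elim (<-irrefl (sym d≡1) 1<d)
  ... | record { factors = p ∷ ps ; isFactorisation = d≡p*ps ; factorsPrime = p-prime ∷ _ } =
    p , p-prime , divides (product ps) (trans d≡p*ps (*-comm p (product ps)))

  factor-< : ∀ {d P r} → 0 < d → 1 < P → d ≡ P * r → 0 < r × r < d
  factor-< {P = P} {zero}  0<d 1<P d≡P*0   = ⊥-elim (<-irrefl (sym (trans d≡P*0 (*-zeroʳ P))) 0<d)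
  factor-< {P = P} {suc r} 0<d 1<P refl = s≤s z≤n , subst (suc r <_) (*-comm (suc r) P) (m<m*n (suc r) P 1<P)

  odd-* : ∀ {m n} → Odd m → Odd n → Odd (m * n)
  odd-* (a , refl) (b , refl) = a + b + 2 * (a * b) , solve 2 (λ a b →
    (con 1 :+ con 2 :* a) :* (con 1 :+ con 2 :* b) := con 1 :+ con 2 :* (a :+ b :+ con 2 :* (a :* b))) refl a b
    where open import Data.Nat.Solver using (module +-*-Solver)
          open +-*-Solver

  1<prime : ∀ {p} → Prime p → 1 < p
  1<prime {p} p-prime = nonTrivial⇒n>1 p {{prime⇒nonTrivial p-prime}}

  1<prime^suc : ∀ {p} → Prime p → ∀ a → 1 < p ^ suc a
  1<prime^suc {p} p-prime a = m<n⇒m<n*o (p ^ a) {{m^n≢0 p a {{prime⇒nonZero p-prime}}}} (1<prime p-prime)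

  prime-power-split : ∀ {p} → Prime p → ∀ d .{{_ : NonZero d}} → p ∣ d
                    → ∃[ a ] ∃[ r ] (d ≡ p ^ suc a * r × ¬ p ∣ r)
  prime-power-split {p} p-prime d p∣d = split d (<-wellFounded d) p∣d
    where
    instance
      _ = prime⇒nonTrivial p-prime
    split : ∀ d .{{_ : NonZero d}} → Acc _<_ d → p ∣ d → ∃[ a ] ∃[ r ] (d ≡ p ^ suc a * r × ¬ p ∣ r)
    split d (acc rec) p∣d@(divides q d≡q*p) with p ∣? q
    ... | no p∤q = 0 , q , trans d≡q*p (trans (*-comm q p) (cong (_* q) (sym (*-identityʳ p)))) , p∤q
    ... | yes p∣q with split q {{quotient≢0 p∣d}} (rec (quotient-< p∣d)) p∣q
    ... | a , r , q≡pᵃ⁺¹r , p∤r = suc a , r , eq , p∤r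
      where
      eq : d ≡ p ^ suc (suc a) * r
      eq = begin
        d                   ≡⟨ d≡q*p ⟩
        q * p               ≡⟨ cong (_* p) q≡pᵃ⁺¹r ⟩
        p ^ suc a * r * p   ≡⟨ *-assoc (p ^ suc a) r p ⟩
        p ^ suc a * (r * p) ≡⟨ cong (p ^ suc a *_) (*-comm r p) ⟩
        p ^ suc a * (p * r) ≡⟨ *-assoc (p ^ suc a) p r ⟨
        p ^ suc a * p * r   ≡⟨ cong (_* r) (*-comm (p ^ suc a) p) ⟩
        p ^ suc (suc a) * r ∎
        where open ≡-Reasoning

open Arithmetic

injective⇒surjective : ∀ {n} (f : Fin n → Fin n) → Injective _≡_ _≡_ f → ∀ y → ∃[ x ] f x ≡ y
injective⇒surjective {suc n} f f-inj y with FinP.any? (λ x → f x FinP.≟ y)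
... | yes hit  = hit
... | no  miss = ⊥-elim (ℕₚ.1+n≰n (FinP.injective⇒≤ f-avoiding-y-injective))
  where
  f≢y : ∀ x → y ≢ f x
  f≢y x y≡fx = miss (x , sym y≡fx)
  f-avoiding-y-injective : Injective _≡_ _≡_ (λ x → Fin.punchOut (f≢y x))
  f-avoiding-y-injective {x} {x′} eq = f-inj (FinP.punchOut-injective (f≢y x) (f≢y x′) eq)

injective⇒permutation : ∀ {n} (f : Fin n → Fin n) → Injective _≡_ _≡_ f → Permutation n n
injective⇒permutation f f-inj = permutation f (proj₁ ∘ surj) (proj₂ ∘ surj) (λ x → f-inj (proj₂ (surj (f x))))
  where
  surj : ∀ y → ∃[ x ] f x ≡ y
  surj = injective⇒surjective f f-inj

module FieldTheory (F : Field) where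
  open Field F
  open import Data.Nat.Divisibility using (_∣_; divides; _∣?_; n∣m*n; m∣m*n; *-monoʳ-∣; >⇒∤; 1∣_)
  open import Data.Nat.Coprimality as Coprimality using (Coprime; coprime-Bézout; coprime-divisor)
  open import Data.Nat.GCD using (module Bézout)
  open import Data.Nat.Primality using (Prime)

  ring : CommutativeRing _ _
  ring = record { isCommutativeRing = isCommutativeRing }

  open CommutativeRing ring public
    using (+-identityˡ; +-identityʳ; -‿inverseˡ; -‿inverseʳ
          ; *-comm; *-assoc; *-identityˡ; *-identityʳ; zeroˡ; zeroʳ; distribˡ; distribʳ)
  open import Algebra.Properties.Ring (CommutativeRing.ring ring) public
    using ( -‿involutive; -‿injective; -‿distribˡ-*; -‿distribʳ-*; -0#≈0#; -1*x≈-x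
          ; +-cancelˡ; +-cancelʳ; x∙y⁻¹≈ε⇒x≈y; //-rightDividesˡ)
  open import Algebra.Definitions.RawSemiring (Semiring.rawSemiring (CommutativeRing.semiring ring)) public
    using (_^_)
  open import Algebra.Properties.Semiring.Exp (CommutativeRing.semiring ring) public
    using (^-homo-*; ^-assocʳ)
  open import Algebra.Properties.CommutativeSemiring.Exp (CommutativeRing.commutativeSemiring ring) public
    using (^-distrib-*)
  open import Algebra.Solver.Ring.NaturalCoefficients.Default (CommutativeRing.commutativeSemiring ring)
    using (solve; _:=_; _:+_; _:*_)

  *-cancelˡ : ∀ {x y z} → x ≢ 0# → x * y ≡ x * z → y ≡ z
  *-cancelˡ {x} {y} {z} x≢0 xy≡xz = begin
    y              ≡⟨ sym (*-identityˡ y) ⟩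
    1# * y         ≡⟨ cong (_* y) (trans (sym x⁻¹x≡1) (*-comm x x⁻¹)) ⟩
    x⁻¹ * x * y    ≡⟨ *-assoc x⁻¹ x y ⟩
    x⁻¹ * (x * y)  ≡⟨ cong (x⁻¹ *_) xy≡xz ⟩
    x⁻¹ * (x * z)  ≡⟨ *-assoc x⁻¹ x z ⟨
    x⁻¹ * x * z    ≡⟨ cong (_* z) (trans (*-comm x⁻¹ x) x⁻¹x≡1) ⟩
    1# * z         ≡⟨ *-identityˡ z ⟩
    z              ∎
    where
    open ≡-Reasoning
    x⁻¹ : Carrier
    x⁻¹ = proj₁ (inverse x x≢0)
    x⁻¹x≡1 : x * x⁻¹ ≡ 1#
    x⁻¹x≡1 = proj₂ (inverse x x≢0)

  x*y≡0⇒y≡0 : ∀ {x y} → x ≢ 0# → x * y ≡ 0# → y ≡ 0#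
  x*y≡0⇒y≡0 {x} x≢0 xy≡0 = *-cancelˡ x≢0 (trans xy≡0 (sym (zeroʳ x)))

  *-≢0 : ∀ {x y} → x ≢ 0# → y ≢ 0# → x * y ≢ 0#
  *-≢0 x≢0 y≢0 xy≡0 = y≢0 (x*y≡0⇒y≡0 x≢0 xy≡0)

  ^-≢0 : ∀ {x} k → x ≢ 0# → x ^ k ≢ 0#
  ^-≢0 zero    x≢0 = 0≢1 ∘ sym
  ^-≢0 (suc k) x≢0 = *-≢0 x≢0 (^-≢0 k x≢0)

  -‿≢0 : ∀ {x} → x ≢ 0# → - x ≢ 0#
  -‿≢0 {x} x≢0 -x≡0 = x≢0 (trans (sym (-‿involutive x)) (trans (cong -_ -x≡0) -0#≈0#))

  1^n≡1 : ∀ n → 1# ^ n ≡ 1#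
  1^n≡1 zero    = refl
  1^n≡1 (suc n) = trans (*-identityˡ _) (1^n≡1 n)

  -‿^-odd : ∀ x {k} → Odd k → (- x) ^ k ≡ - (x ^ k)
  -‿^-odd x (t , refl) = begin
    - x * (- x) ^ (2 ℕ.* t)  ≡⟨ cong (- x *_) (^-assocʳ (- x) 2 t) ⟨
    - x * ((- x) ^ 2) ^ t    ≡⟨ cong (λ y → - x * y ^ t) -x²≡x² ⟩
    - x * (x ^ 2) ^ t        ≡⟨ cong (- x *_) (^-assocʳ x 2 t) ⟩
    - x * x ^ (2 ℕ.* t)      ≡⟨ -‿distribˡ-* x _ ⟨
    - (x * x ^ (2 ℕ.* t))    ∎
    where
    open ≡-Reasoning
    -x²≡x² : (- x) ^ 2 ≡ x ^ 2
    -x²≡x² = begin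
      - x * (- x * 1#)   ≡⟨ -‿distribˡ-* x _ ⟨
      - (x * (- x * 1#)) ≡⟨ cong (λ y → - (x * y)) (sym (-‿distribˡ-* x 1#)) ⟩
      - (x * - (x * 1#)) ≡⟨ cong -_ (-‿distribʳ-* x _) ⟨
      - - (x * (x * 1#)) ≡⟨ -‿involutive _ ⟩
      x * (x * 1#)       ∎

  ^≡1-∣ : ∀ z a {k} → z ^ a ≡ 1# → a ∣ k → z ^ k ≡ 1#
  ^≡1-∣ z a zᵃ≡1 (divides q refl) = begin
    z ^ (q ℕ.* a)  ≡⟨ cong (z ^_) (ℕₚ.*-comm q a) ⟩
    z ^ (a ℕ.* q)  ≡⟨ ^-assocʳ z a q ⟨
    (z ^ a) ^ q    ≡⟨ cong (_^ q) zᵃ≡1 ⟩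
    1# ^ q         ≡⟨ 1^n≡1 q ⟩
    1#             ∎
    where open ≡-Reasoning

  ^-Bézout : ∀ {z d a b} → Bézout.Identity d a b → z ^ a ≡ 1# → z ^ b ≡ 1# → z ^ d ≡ 1#
  ^-Bézout {z} {d} {a} {b} (Bézout.+- x y d+yb≡xa) zᵃ≡1 zᵇ≡1 =
    ^-summand (trans (cong (z ^_) d+yb≡xa) (^≡1-∣ z a zᵃ≡1 (n∣m*n x))) (^≡1-∣ z b zᵇ≡1 (n∣m*n y))
    where
    ^-summand : ∀ {e} → z ^ (d ℕ.+ e) ≡ 1# → z ^ e ≡ 1# → z ^ d ≡ 1#
    ^-summand {e} zᵈ⁺ᵉ≡1 zᵉ≡1 = trans (sym (*-identityʳ _)) (trans (cong (z ^ d *_) (sym zᵉ≡1))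
                                  (trans (sym (^-homo-* z d e)) zᵈ⁺ᵉ≡1))
  ^-Bézout (Bézout.-+ x y d+xa≡yb) zᵃ≡1 zᵇ≡1 = ^-Bézout (Bézout.+- y x d+xa≡yb) zᵇ≡1 zᵃ≡1

  record HasOrder (z : Carrier) (d : ℕ) : Set where
    field
      ^order≡1 : z ^ d ≡ 1#
      order∣   : ∀ {k} → z ^ k ≡ 1# → d ∣ k

  open HasOrder public

  HasOrder⇒^≡1 : ∀ {z d k} → HasOrder z d → d ∣ k → z ^ k ≡ 1#
  HasOrder⇒^≡1 {z} {d} z-ord = ^≡1-∣ z d (^order≡1 z-ord)

  HasOrder-1 : HasOrder 1# 1
  HasOrder-1 = record { ^order≡1 = *-identityʳ 1# ; order∣ = λ _ → 1∣ _ }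

  HasOrder⇒≢0 : ∀ {z d} → 0 < d → HasOrder z d → z ≢ 0#
  HasOrder⇒≢0 {z} {suc d} _ z-ord z≡0 = 0≢1 (begin
    0#             ≡⟨ zeroˡ _ ⟨
    0# * z ^ d     ≡⟨ cong (_* z ^ d) z≡0 ⟨
    z ^ suc d      ≡⟨ ^order≡1 z-ord ⟩
    1#             ∎)
    where open ≡-Reasoning

  HasOrder⇒≢1 : ∀ {z d} → 1 < d → HasOrder z d → z ≢ 1#
  HasOrder⇒≢1 {z} 1<d z-ord z≡1 = >⇒∤ 1<d (order∣ z-ord (trans (*-identityʳ z) z≡1))

  ^-injective-≤ : ∀ {z d a b} → HasOrder z d → a ≤ b → b < d → z ^ a ≡ z ^ b → a ≡ b
  ^-injective-≤ {z} {d} {a} {b} z-ord a≤b b<d zᵃ≡zᵇ with b ℕ.∸ a | ℕₚ.m+[n∸m]≡n a≤b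
  ... | zero  | a+0≡b = trans (sym (ℕₚ.+-identityʳ a)) a+0≡b
  ... | suc t | refl  = ⊥-elim (>⇒∤ (ℕₚ.≤-<-trans (ℕₚ.m≤n+m (suc t) a) b<d) (order∣ z-ord zᵗ⁺¹≡1))
    where
    zᵗ⁺¹≡1 : z ^ suc t ≡ 1#
    zᵗ⁺¹≡1 = *-cancelˡ (^-≢0 a (HasOrder⇒≢0 (ℕₚ.m<n⇒0<n b<d) z-ord))
               (trans (sym (^-homo-* z a (suc t))) (trans (sym zᵃ≡zᵇ) (sym (*-identityʳ _))))

  ^-injective : ∀ {z d a b} → HasOrder z d → a < d → b < d → z ^ a ≡ z ^ b → a ≡ b
  ^-injective {a = a} {b} z-ord a<d b<d zᵃ≡zᵇ with ℕₚ.≤-total a b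
  ... | inj₁ a≤b = ^-injective-≤ z-ord a≤b b<d zᵃ≡zᵇ
  ... | inj₂ b≤a = sym (^-injective-≤ z-ord b≤a a<d (sym zᵃ≡zᵇ))

  prime-order∣ : ∀ {p z k} → Prime p → z ^ p ≡ 1# → z ≢ 1# → z ^ k ≡ 1# → p ∣ k
  prime-order∣ {p} {z} {k} p-prime zᵖ≡1 z≢1 zᵏ≡1 with p ∣? k
  ... | yes p∣k = p∣k
  ... | no  p∤k = ⊥-elim (z≢1 (trans (sym (*-identityʳ z))
                    (^-Bézout (coprime-Bézout (prime∤⇒coprime p-prime p∤k)) zᵖ≡1 zᵏ≡1)))

  -- In the step, z ^ p ^ (a + 1) has order p, so k = q * p, and z ^ p meets the hypotheses at a and q.
  prime-power-order∣ : ∀ {p} → Prime p → ∀ {z} a {k} → z ^ (p ℕ.^ suc a) ≡ 1# → z ^ (p ℕ.^ a) ≢ 1#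
                     → z ^ k ≡ 1# → p ℕ.^ suc a ∣ k
  prime-power-order∣ {p} p-prime {z} zero {k} zᵖ≡1 z≢1 zᵏ≡1 =
    subst (_∣ k) (sym p*1≡p)
      (prime-order∣ {k = k} p-prime (subst (λ e → z ^ e ≡ 1#) p*1≡p zᵖ≡1) (z≢1 ∘ trans (*-identityʳ z)) zᵏ≡1)
    where
    p*1≡p : p ℕ.* 1 ≡ p
    p*1≡p = ℕₚ.*-identityʳ p
  prime-power-order∣ {p} p-prime {z} (suc a) {k} zᵖᵃ⁺²≡1 zᵖᵃ⁺¹≢1 zᵏ≡1
    with prime-order∣ {k = k} p-prime u^p≡1 zᵖᵃ⁺¹≢1 uᵏ≡1
    where
    u^p≡1 : (z ^ (p ℕ.^ suc a)) ^ p ≡ 1#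
    u^p≡1 = trans (^-assocʳ z (p ℕ.^ suc a) p) (trans (cong (z ^_) (ℕₚ.*-comm (p ℕ.^ suc a) p)) zᵖᵃ⁺²≡1)
    uᵏ≡1 : (z ^ (p ℕ.^ suc a)) ^ k ≡ 1#
    uᵏ≡1 = trans (^-assocʳ z (p ℕ.^ suc a) k) (^≡1-∣ z k zᵏ≡1 (n∣m*n (p ℕ.^ suc a)))
  ... | divides q refl = subst (p ℕ.^ suc (suc a) ∣_) (ℕₚ.*-comm p q) (*-monoʳ-∣ p pᵃ⁺¹∣q)
    where
    pᵃ⁺¹∣q : p ℕ.^ suc a ∣ q
    pᵃ⁺¹∣q = prime-power-order∣ p-prime a
      (trans (^-assocʳ z p (p ℕ.^ suc a)) zᵖᵃ⁺²≡1)
      (zᵖᵃ⁺¹≢1 ∘ trans (sym (^-assocʳ z p (p ℕ.^ a))))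
      (trans (^-assocʳ z p q) (trans (cong (z ^_) (ℕₚ.*-comm p q)) zᵏ≡1))

  HasOrder-prime-power : ∀ {p z} → Prime p → ∀ a
                       → z ^ (p ℕ.^ suc a) ≡ 1# → z ^ (p ℕ.^ a) ≢ 1# → HasOrder z (p ℕ.^ suc a)
  HasOrder-prime-power p-prime a zᵖᵃ⁺¹≡1 zᵖᵃ≢1 =
    record { ^order≡1 = zᵖᵃ⁺¹≡1 ; order∣ = prime-power-order∣ p-prime a zᵖᵃ⁺¹≡1 zᵖᵃ≢1 }

  HasOrder-* : ∀ {x y d e} → Coprime d e → HasOrder x d → HasOrder y e → HasOrder (x * y) (d ℕ.* e)
  HasOrder-* {x} {y} {d} {e} d⊥e x-ord y-ord = record
    { ^order≡1 = begin
        (x * y) ^ (d ℕ.* e)            ≡⟨ ^-distrib-* x y (d ℕ.* e) ⟩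
        x ^ (d ℕ.* e) * y ^ (d ℕ.* e)  ≡⟨ cong₂ _*_ (HasOrder⇒^≡1 x-ord (m∣m*n e)) (HasOrder⇒^≡1 y-ord (n∣m*n d)) ⟩
        1# * 1#                        ≡⟨ *-identityˡ 1# ⟩
        1#                             ∎
    ; order∣ = λ {k} xyᵏ≡1 → coprime-∣-* d⊥e
        (order∣-factor {k = k} d⊥e x-ord y-ord xyᵏ≡1)
        (order∣-factor {k = k} (Coprimality.sym d⊥e) y-ord x-ord (subst (λ w → w ^ k ≡ 1#) (*-comm x y) xyᵏ≡1))
    }
    where
    open ≡-Reasoning
    order∣-factor : ∀ {x y d e k} → Coprime d e → HasOrder x d → HasOrder y e → (x * y) ^ k ≡ 1# → d ∣ k
    order∣-factor {x} {y} {d} {e} {k} d⊥e x-ord y-ord xyᵏ≡1 = coprime-divisor d⊥e (order∣ x-ord (begin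
      x ^ (e ℕ.* k)                  ≡⟨ *-identityʳ _ ⟨
      x ^ (e ℕ.* k) * 1#             ≡⟨ cong (x ^ (e ℕ.* k) *_) (HasOrder⇒^≡1 y-ord (m∣m*n k)) ⟨
      x ^ (e ℕ.* k) * y ^ (e ℕ.* k)  ≡⟨ ^-distrib-* x y (e ℕ.* k) ⟨
      (x * y) ^ (e ℕ.* k)            ≡⟨ ^≡1-∣ (x * y) k xyᵏ≡1 (n∣m*n e) ⟩
      1#                             ∎))

  ∃-HasOrder-* : ∀ {d e} → Coprime d e → ∃[ x ] HasOrder x d → ∃[ y ] HasOrder y e
               → ∃[ z ] HasOrder z (d ℕ.* e)
  ∃-HasOrder-* d⊥e (x , x-ord) (y , y-ord) = x * y , HasOrder-* d⊥e x-ord y-ord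

  HasOrder-^-coprime : ∀ {z m n} → Coprime m n → HasOrder z m → HasOrder (z ^ n) m
  HasOrder-^-coprime {z} {m} {n} m⊥n z-ord = record
    { ^order≡1 = trans (^-assocʳ z n m) (HasOrder⇒^≡1 z-ord (n∣m*n n))
    ; order∣   = λ zⁿᵏ≡1 → coprime-divisor m⊥n (order∣ z-ord (trans (sym (^-assocʳ z n _)) zⁿᵏ≡1))
    }

  Poly : ℕ → Set
  Poly = Vec Carrier

  eval : ∀ {k} → Poly k → Carrier → Carrier
  eval []       x = 0#
  eval (c ∷ cs) x = c + x * eval cs x

  divideBy : ∀ {k} → Carrier → Poly (suc k) → Poly k
  divideBy a (c ∷ [])      = []
  divideBy a (c ∷ c′ ∷ cs) = eval (c′ ∷ cs) a ∷ divideBy a (c′ ∷ cs)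

  eval-divideBy : ∀ {k} a (f : Poly (suc k)) x → eval f x ≡ eval f a + (x + - a) * eval (divideBy a f) x
  eval-divideBy a (c ∷ []) x = begin
    c + x * 0#                    ≡⟨ cong (c +_) (trans (zeroʳ x) (sym (zeroʳ a))) ⟩
    c + a * 0#                    ≡⟨ +-identityʳ _ ⟨
    c + a * 0# + 0#               ≡⟨ cong (c + a * 0# +_) (zeroʳ (x + - a)) ⟨
    c + a * 0# + (x + - a) * 0#   ∎
    where open ≡-Reasoning
  eval-divideBy a (c ∷ g@(c′ ∷ cs)) x = begin
    c + x * eval g x              ≡⟨ cong (λ y → c + x * y) (eval-divideBy a g x) ⟩
    c + x * (G + d * Q)           ≡⟨ cong (λ y → c + y * (G + d * Q)) (//-rightDividesˡ a x) ⟨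
    c + (d + a) * (G + d * Q)     ≡⟨ solve 5 (λ c d a G Q → c :+ (d :+ a) :* (G :+ d :* Q)
                                                := (c :+ a :* G) :+ d :* (G :+ (d :+ a) :* Q)) refl c d a G Q ⟩
    c + a * G + d * (G + (d + a) * Q) ≡⟨ cong (λ y → c + a * G + d * (G + y * Q)) (//-rightDividesˡ a x) ⟩
    c + a * G + d * (G + x * Q)   ∎
    where
    open ≡-Reasoning
    G d Q : Carrier
    G = eval g a
    d = x + - a
    Q = eval (divideBy a g) x

  vanishing-everywhere : ∀ k (f : Poly k) (p : Fin k → Carrier) → Injective _≡_ _≡_ p
                       → (∀ i → eval f (p i) ≡ 0#) → ∀ x → eval f x ≡ 0#
  vanishing-everywhere zero    []  p p-inj f[p]≡0 x = refl
  vanishing-everywhere (suc k) f   p p-inj f[p]≡0 x = begin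
    eval f x                                ≡⟨ eval-divideBy a f x ⟩
    eval f a + (x + - a) * eval (divideBy a f) x ≡⟨ cong₂ (λ u v → u + (x + - a) * v) (f[p]≡0 zero) q≡0 ⟩
    0# + (x + - a) * 0#                      ≡⟨ trans (+-identityˡ _) (zeroʳ _) ⟩
    0#                                       ∎
    where
    open ≡-Reasoning
    a : Carrier
    a = p zero
    q[p]≡0 : ∀ i → eval (divideBy a f) (p (suc i)) ≡ 0#
    q[p]≡0 i = x*y≡0⇒y≡0 (λ b-a≡0 → FinP.0≢1+n (p-inj (sym (x∙y⁻¹≈ε⇒x≈y _ _ b-a≡0)))) (begin
      (b + - a) * eval (divideBy a f) b              ≡⟨ +-identityˡ _ ⟨
      0# + (b + - a) * eval (divideBy a f) b         ≡⟨ cong (_+ (b + - a) * eval (divideBy a f) b) (f[p]≡0 zero) ⟨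
      eval f a + (b + - a) * eval (divideBy a f) b   ≡⟨ eval-divideBy a f b ⟨
      eval f b                                       ≡⟨ f[p]≡0 (suc i) ⟩
      0#                                             ∎)
      where
      b : Carrier
      b = p (suc i)
    q≡0 : eval (divideBy a f) x ≡ 0#
    q≡0 = vanishing-everywhere k (divideBy a f) (p ∘ suc) (FinP.suc-injective ∘ p-inj) q[p]≡0 x

  monomial : ∀ k → Poly (suc k)
  monomial zero    = 1# ∷ []
  monomial (suc k) = 0# ∷ monomial k

  eval-monomial : ∀ k x → eval (monomial k) x ≡ x ^ k
  eval-monomial zero    x = trans (cong (1# +_) (zeroʳ x)) (+-identityʳ 1#)
  eval-monomial (suc k) x = trans (+-identityˡ _) (cong (x *_) (eval-monomial k x))

  roots-of-unity-bound : ∀ M (p : Fin (suc (suc M)) → Carrier) → Injective _≡_ _≡_ p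
                       → ¬ (∀ i → p i ^ suc M ≡ 1#)
  roots-of-unity-bound M p p-inj p[i]ᴹ⁺¹≡1 = -‿≢0 (0≢1 ∘ sym) (begin
    - 1#                              ≡⟨ +-identityʳ _ ⟨
    - 1# + 0#                         ≡⟨ cong (- 1# +_) (zeroˡ _) ⟨
    eval Xᴹ⁺¹-1 0#                    ≡⟨ vanishing-everywhere _ Xᴹ⁺¹-1 p p-inj roots 0# ⟩
    0#                                ∎)
    where
    open ≡-Reasoning
    Xᴹ⁺¹-1 : Poly (suc (suc M))
    Xᴹ⁺¹-1 = - 1# ∷ monomial M
    roots : ∀ i → eval Xᴹ⁺¹-1 (p i) ≡ 0#
    roots i = begin
      - 1# + p i * eval (monomial M) (p i)  ≡⟨ cong (λ y → - 1# + p i * y) (eval-monomial M (p i)) ⟩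
      - 1# + p i ^ suc M                    ≡⟨ cong (- 1# +_) (p[i]ᴹ⁺¹≡1 i) ⟩
      - 1# + 1#                             ≡⟨ -‿inverseˡ 1# ⟩
      0#                                    ∎

  open HeffterDefs F using (sumF; psum)

  sumF-*ˡ : ∀ c k (f : Fin k → Carrier) → sumF k (λ j → c * f j) ≡ c * sumF k f
  sumF-*ˡ c zero    f = sym (zeroʳ c)
  sumF-*ˡ c (suc k) f = trans (cong (c * f zero +_) (sumF-*ˡ c k (f ∘ suc))) (sym (distribˡ c _ _))

  sumF-*ʳ : ∀ c k (f : Fin k → Carrier) → sumF k (λ j → f j * c) ≡ sumF k f * c
  sumF-*ʳ c zero    f = sym (zeroˡ c)
  sumF-*ʳ c (suc k) f = trans (cong (f zero * c +_) (sumF-*ʳ c k (f ∘ suc))) (sym (distribʳ c _ _))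

  geometric : Carrier → ℕ → Carrier
  geometric z k = sumF k (λ j → z ^ Fin.toℕ j)

  geometric-suc : ∀ z k → geometric z (suc k) ≡ 1# + z * geometric z k
  geometric-suc z k = cong (1# +_) (sumF-*ˡ z k (λ j → z ^ Fin.toℕ j))

  geometric-telescope : ∀ z k → z * geometric z k + 1# ≡ geometric z k + z ^ k
  geometric-telescope z zero    = cong (_+ 1#) (zeroʳ z)
  geometric-telescope z (suc k) = begin
    z * geometric z (suc k) + 1#    ≡⟨ cong (λ y → z * y + 1#) (geometric-suc z k) ⟩
    z * (1# + z * G) + 1#           ≡⟨ solve 3 (λ z G o → z :* (o :+ z :* G) :+ o := o :+ z :* (z :* G :+ o))
                                               refl z G 1# ⟩
    1# + z * (z * G + 1#)           ≡⟨ cong (λ y → 1# + z * y) (geometric-telescope z k) ⟩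
    1# + z * (G + z ^ k)            ≡⟨ solve 4 (λ z G t o → o :+ z :* (G :+ t) := (o :+ z :* G) :+ z :* t)
                                               refl z G (z ^ k) 1# ⟩
    1# + z * G + z ^ suc k          ≡⟨ cong (_+ z ^ suc k) (geometric-suc z k) ⟨
    geometric z (suc k) + z ^ suc k ∎
    where
    open ≡-Reasoning
    G : Carrier
    G = geometric z k

  geometric≡0 : ∀ {z} k → z ^ k ≡ 1# → z ≢ 1# → geometric z k ≡ 0#
  geometric≡0 {z} k zᵏ≡1 z≢1 = x*y≡0⇒y≡0 (z≢1 ∘ x∙y⁻¹≈ε⇒x≈y z 1#) (begin
    (z + - 1#) * G        ≡⟨ distribʳ G z (- 1#) ⟩
    z * G + - 1# * G      ≡⟨ cong₂ (λ u v → u + v) zG≡G (-1*x≈-x G) ⟩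
    G + - G               ≡⟨ -‿inverseʳ G ⟩
    0#                    ∎)
    where
    open ≡-Reasoning
    G : Carrier
    G = geometric z k
    zG≡G : z * G ≡ G
    zG≡G = +-cancelʳ 1# (z * G) G (trans (geometric-telescope z k) (cong (G +_) zᵏ≡1))

  psum-geometric : ∀ {c z k} (f : Fin k → Carrier) → (∀ j → f j ≡ c * z ^ Fin.toℕ j)
                 → ∀ j → psum f j ≡ c * geometric z (suc (Fin.toℕ j))
  psum-geometric {c} f f≡cz^ zero = trans (f≡cz^ zero) (cong (c *_) (sym (+-identityʳ 1#)))
  psum-geometric {c} {z} {suc k} f f≡cz^ (suc j) = begin
    f zero + psum (f ∘ suc) j     ≡⟨ cong₂ _+_ (f≡cz^ zero) (psum-geometric (f ∘ suc) f∘suc≡czz^ j) ⟩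
    c * 1# + (c * z) * G          ≡⟨ cong (c * 1# +_) (*-assoc c z G) ⟩
    c * 1# + c * (z * G)          ≡⟨ distribˡ c 1# _ ⟨
    c * (1# + z * G)              ≡⟨ cong (c *_) (geometric-suc z (suc (Fin.toℕ j))) ⟨
    c * geometric z (suc (suc (Fin.toℕ j))) ∎
    where
    open ≡-Reasoning
    G : Carrier
    G = geometric z (suc (Fin.toℕ j))
    f∘suc≡czz^ : ∀ i → f (suc i) ≡ (c * z) * z ^ Fin.toℕ i
    f∘suc≡czz^ i = trans (f≡cz^ (suc i)) (sym (*-assoc c z _))

  psum-geometric-injective : ∀ {c z d} → HasOrder z d → c ≢ 0# → (f : Fin d → Carrier)
                           → (∀ j → f j ≡ c * z ^ Fin.toℕ j) → Injective _≡_ _≡_ (psum f)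
  psum-geometric-injective {c} {z} z-ord c≢0 f f≡cz^ {i} {j} Σᵢ≡Σⱼ =
    FinP.toℕ-injective (^-injective z-ord (FinP.toℕ<n i) (FinP.toℕ<n j) (*-cancelˡ z≢0 zᵃ⁺¹≡zᵇ⁺¹))
    where
    z≢0 : z ≢ 0#
    z≢0 = HasOrder⇒≢0 (ℕₚ.m<n⇒0<n (FinP.toℕ<n i)) z-ord
    a b : ℕ
    a = suc (Fin.toℕ i)
    b = suc (Fin.toℕ j)
    Gₐ≡G_b : geometric z a ≡ geometric z b
    Gₐ≡G_b = *-cancelˡ c≢0
      (trans (sym (psum-geometric f f≡cz^ i)) (trans Σᵢ≡Σⱼ (psum-geometric f f≡cz^ j)))
    zᵃ⁺¹≡zᵇ⁺¹ : z ^ a ≡ z ^ b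
    zᵃ⁺¹≡zᵇ⁺¹ = +-cancelˡ (geometric z a) _ _ (begin
      geometric z a + z ^ a      ≡⟨ geometric-telescope z a ⟨
      z * geometric z a + 1#     ≡⟨ cong (λ y → z * y + 1#) Gₐ≡G_b ⟩
      z * geometric z b + 1#     ≡⟨ geometric-telescope z b ⟩
      geometric z b + z ^ b      ≡⟨ cong (_+ z ^ b) Gₐ≡G_b ⟨
      geometric z a + z ^ b      ∎)
      where open ≡-Reasoning

module FiniteField (F : Field) (N : ℕ) (enumeration : Field.Carrier F ↔ Fin (suc N)) where
  open Field F
  open FieldTheory F
  open Inverse enumeration using (to; from; strictlyInverseˡ; strictlyInverseʳ)
  open import Algebra.Properties.CommutativeMonoid.Sum (CommutativeRing.+-commutativeMonoid ring) as Σ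
    using ()
  open import Algebra.Definitions.RawMonoid (CommutativeRing.+-rawMonoid ring) using () renaming (_×_ to _·_)
  open import Algebra.Properties.Monoid.Mult (CommutativeRing.+-monoid ring) using (×-assocˡ)
  open import Data.Nat.Divisibility using (_∣_; divides; ∣-trans; 0∣⇒≡0)
  open import Data.Nat.Induction using (<-wellFounded)
  open import Data.Nat.Primality using (Prime)
  open import Algebra.Properties.CommutativeMonoid.Sum (CommutativeRing.*-commutativeMonoid ring) as Π
    using ()

  to-injective : Injective _≡_ _≡_ to
  to-injective = Injection.injective (↔⇒↣ enumeration)

  from-injective : Injective _≡_ _≡_ from
  from-injective = Injection.injective (↔⇒↣ (↔-sym enumeration))

  infix 4 _≟_
  _≟_ : DecidableEquality Carrier
  x ≟ y = map′ to-injective (cong to) (to x FinP.≟ to y)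

  nonzero : Fin N → Carrier
  nonzero i = from (Fin.punchIn (to 0#) i)

  nonzero-≢0 : ∀ i → nonzero i ≢ 0#
  nonzero-≢0 i eq = FinP.punchInᵢ≢i (to 0#) i (trans (sym (strictlyInverseˡ _)) (cong to eq))

  nonzero-injective : Injective _≡_ _≡_ nonzero
  nonzero-injective {i} {j} eq =
    FinP.punchIn-injective (to 0#) i j (trans (sym (strictlyInverseˡ _)) (trans (cong to eq) (strictlyInverseˡ _)))

  index : ∀ x → x ≢ 0# → Fin N
  index x x≢0 = Fin.punchOut (x≢0 ∘ sym ∘ to-injective)

  nonzero-index : ∀ x (x≢0 : x ≢ 0#) → nonzero (index x x≢0) ≡ x
  nonzero-index x x≢0 = trans (cong from (FinP.punchIn-punchOut _)) (strictlyInverseʳ x)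

  index-injective : ∀ {k} (g : Fin k → Carrier) (g≢0 : ∀ i → g i ≢ 0#) → Injective _≡_ _≡_ g
                  → Injective _≡_ _≡_ (λ i → index (g i) (g≢0 i))
  index-injective g g≢0 g-injective {i} {j} σi≡σj = g-injective (begin
    g i                        ≡⟨ nonzero-index (g i) (g≢0 i) ⟨
    nonzero (index (g i) (g≢0 i)) ≡⟨ cong nonzero σi≡σj ⟩
    nonzero (index (g j) (g≢0 j)) ≡⟨ nonzero-index (g j) (g≢0 j) ⟩
    g j                        ∎)
    where open ≡-Reasoning

  Π-≢0 : ∀ k (f : Fin k → Carrier) → (∀ i → f i ≢ 0#) → Π.sum f ≢ 0#
  Π-≢0 zero    f f≢0 = 0≢1 ∘ sym
  Π-≢0 (suc k) f f≢0 = *-≢0 (f≢0 zero) (Π-≢0 k (f ∘ suc) (f≢0 ∘ suc))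

  fermat : ∀ {x} → x ≢ 0# → x ^ N ≡ 1#
  fermat {x} x≢0 = *-cancelˡ (Π-≢0 N nonzero nonzero-≢0) (begin
    P * x ^ N                    ≡⟨ *-comm P (x ^ N) ⟩
    x ^ N * P                    ≡⟨ cong (_* P) (Π.sum-replicate N {x}) ⟨
    Π.sum {N} (λ _ → x) * P      ≡⟨ Π.∑-distrib-+ (λ _ → x) nonzero ⟨
    Π.sum (λ i → x * nonzero i)  ≡⟨ Π.sum-cong-≗ (λ i → sym (nonzero-index _ (x*nonzero≢0 i))) ⟩
    Π.sum (nonzero ∘ σ)          ≡⟨ Π.sum-permute nonzero (injective⇒permutation σ σ-injective) ⟨
    P                            ≡⟨ *-identityʳ P ⟨
    P * 1#                       ∎)
    where
    open ≡-Reasoning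
    P : Carrier
    P = Π.sum nonzero
    x*nonzero≢0 : ∀ i → x * nonzero i ≢ 0#
    x*nonzero≢0 i = *-≢0 x≢0 (nonzero-≢0 i)
    σ : Fin N → Fin N
    σ i = index (x * nonzero i) (x*nonzero≢0 i)
    σ-injective : Injective _≡_ _≡_ σ
    σ-injective = index-injective (λ i → x * nonzero i) x*nonzero≢0 (nonzero-injective ∘ *-cancelˡ x≢0)

  -- Adding 1 permutes F, so it leaves the sum of all elements unchanged.
  card·1≡0 : suc N · 1# ≡ 0#
  card·1≡0 = +-cancelˡ S _ _ (begin
    S + suc N · 1#               ≡⟨ cong (S +_) (Σ.sum-replicate (suc N) {1#}) ⟨
    S + Σ.sum {suc N} (λ _ → 1#) ≡⟨ Σ.∑-distrib-+ from (λ _ → 1#) ⟨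
    Σ.sum (λ i → from i + 1#)    ≡⟨ Σ.sum-cong-≗ (λ i → sym (strictlyInverseʳ (from i + 1#))) ⟩
    Σ.sum (from ∘ σ)             ≡⟨ Σ.sum-permute from (injective⇒permutation σ σ-injective) ⟨
    S                            ≡⟨ +-identityʳ S ⟨
    S + 0#                       ∎)
    where
    open ≡-Reasoning
    S : Carrier
    S = Σ.sum from
    σ : Fin (suc N) → Fin (suc N)
    σ i = to (from i + 1#)
    σ-injective : Injective _≡_ _≡_ σ
    σ-injective {i} {j} σi≡σj = from-injective (+-cancelʳ 1# _ _ (begin
      from i + 1#         ≡⟨ strictlyInverseʳ _ ⟨
      from (σ i)          ≡⟨ cong from σi≡σj ⟩
      from (σ j)          ≡⟨ strictlyInverseʳ _ ⟩
      from j + 1#         ∎))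

  2∣N⇒1+1≢0 : 2 ∣ N → 1# + 1# ≢ 0#
  2∣N⇒1+1≢0 (divides K refl) 1+1≡0 = 0≢1 (begin
    0#                     ≡⟨ card·1≡0 ⟨
    1# + (K ℕ.* 2) · 1#    ≡⟨ cong (1# +_) (×-assocˡ 1# K 2) ⟨
    1# + K · (2 · 1#)      ≡⟨ cong (λ y → 1# + K · y) (trans (cong (1# +_) (+-identityʳ 1#)) 1+1≡0) ⟩
    1# + K · 0#            ≡⟨ cong (1# +_) (trans (sym (Σ.sum-replicate K {0#})) (Σ.sum-replicate-zero K)) ⟩
    1# + 0#                ≡⟨ +-identityʳ 1# ⟩
    1#                     ∎)
    where open ≡-Reasoning

  0<N : 0 < N
  0<N = ℕₚ.m<n⇒0<n (FinP.toℕ<n (index 1# (0≢1 ∘ sym)))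

  ∃-non-root-of-unity : ∀ M → 0 < M → M < N → ∃[ x ] (x ≢ 0# × x ^ M ≢ 1#)
  ∃-non-root-of-unity (suc M) _ M<N = p (proj₁ non-root) , nonzero-≢0 _ , proj₂ non-root
    where
    p : Fin (suc (suc M)) → Carrier
    p i = nonzero (Fin.inject≤ i M<N)
    p-injective : Injective _≡_ _≡_ p
    p-injective {i} {j} = FinP.inject≤-injective M<N M<N i j ∘ nonzero-injective
    non-root : ∃[ i ] p i ^ suc M ≢ 1#
    non-root = FinP.¬∀⟶∃¬ _ (λ i → p i ^ suc M ≡ 1#) (λ i → p i ^ suc M ≟ 1#)
                 (roots-of-unity-bound M p p-injective)

  -- With N = c * p ^ (a + 1), the root bound yields y with y ^ (c * p ^ a) ≢ 1, and y ^ c has order p ^ (a + 1).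
  ∃-prime-power-order : ∀ {p} → Prime p → ∀ a → p ℕ.^ suc a ∣ N → ∃[ z ] HasOrder z (p ℕ.^ suc a)
  ∃-prime-power-order {p} p-prime a (divides c N≡c*pᵃ⁺¹) =
    y ^ c , HasOrder-prime-power p-prime a yᶜᵖᵃ⁺¹≡1 yᶜᵖᵃ≢1
    where
    M : ℕ
    M = c ℕ.* p ℕ.^ a
    N≡p*M : N ≡ p ℕ.* M
    N≡p*M = trans N≡c*pᵃ⁺¹ (trans (sym (ℕₚ.*-assoc c p _))
              (trans (cong (ℕ._* p ℕ.^ a) (ℕₚ.*-comm c p)) (ℕₚ.*-assoc p c _)))
    M-bounds : 0 < M × M < N
    M-bounds = factor-< 0<N (1<prime p-prime) N≡p*M
    non-root : ∃[ y ] (y ≢ 0# × y ^ M ≢ 1#)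
    non-root = ∃-non-root-of-unity M (proj₁ M-bounds) (proj₂ M-bounds)
    y : Carrier
    y = proj₁ non-root
    yᶜᵖᵃ⁺¹≡1 : (y ^ c) ^ (p ℕ.^ suc a) ≡ 1#
    yᶜᵖᵃ⁺¹≡1 = trans (^-assocʳ y c _) (trans (cong (y ^_) (sym N≡c*pᵃ⁺¹)) (fermat (proj₁ (proj₂ non-root))))
    yᶜᵖᵃ≢1 : (y ^ c) ^ (p ℕ.^ a) ≢ 1#
    yᶜᵖᵃ≢1 = proj₂ (proj₂ non-root) ∘ trans (sym (^-assocʳ y c _))

  ∃-order : ∀ d → d ∣ N → ∃[ z ] HasOrder z d
  ∃-order d = go d (<-wellFounded d)
    where
    go : ∀ d → Acc _<_ d → d ∣ N → ∃[ z ] HasOrder z d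
    go zero          _         0∣N = ⊥-elim (ℕₚ.<-irrefl (sym (0∣⇒≡0 0∣N)) 0<N)
    go (suc zero)    _         _   = 1# , HasOrder-1
    go d@(suc (suc _)) (acc rec) d∣N with ∃-prime-divisor d (s≤s (s≤s z≤n))
    ... | p , p-prime , p∣d with prime-power-split p-prime d p∣d
    ... | a , r , d≡pᵃ⁺¹r , p∤r =
      subst (λ d → ∃[ z ] HasOrder z d) (sym d≡pᵃ⁺¹r)
        (∃-HasOrder-* (prime∤⇒coprime-^ p-prime p∤r (suc a))
          (∃-prime-power-order p-prime a (∣-trans (divides r (trans d≡pᵃ⁺¹r (ℕₚ.*-comm _ r))) d∣N))
          (go r (rec r<d) (∣-trans (divides (p ℕ.^ suc a) d≡pᵃ⁺¹r) d∣N)))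
      where
      r<d : r < d
      r<d = proj₂ (factor-< (s≤s z≤n) (1<prime^suc p-prime a) d≡pᵃ⁺¹r)

  nonzero-cover : (g : Fin N → Carrier) → (∀ k → g k ≢ 0#) → Injective _≡_ _≡_ g
                → ∀ x → x ≢ 0# → ∃[ k ] g k ≡ x
  nonzero-cover g g≢0 g-injective x x≢0 = k , (begin
    g k                   ≡⟨ nonzero-index (g k) (g≢0 k) ⟨
    nonzero (σ k)         ≡⟨ cong nonzero σk≡σx ⟩
    nonzero (index x x≢0) ≡⟨ nonzero-index x x≢0 ⟩
    x                     ∎)
    where
    open ≡-Reasoning
    σ : Fin N → Fin N
    σ k = index (g k) (g≢0 k)
    σ-injective : Injective _≡_ _≡_ σ
    σ-injective = index-injective g g≢0 g-injective
    hit : ∃[ k ] σ k ≡ index x x≢0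
    hit = injective⇒surjective σ σ-injective (index x x≢0)
    k : Fin N
    k = proj₁ hit
    σk≡σx : σ k ≡ index x x≢0
    σk≡σx = proj₂ hit

module Construction (F : Field) (m n : ℕ) (enumeration : Field.Carrier F ↔ Fin (suc (2 ℕ.* m ℕ.* n)))
                    (1<m : 1 < m) (1<n : 1 < n) (m-odd : Odd m) (n-odd : Odd n) (m⊥n : Coprime m n) where
  open Field F
  open FieldTheory F
  open FiniteField F (2 ℕ.* m ℕ.* n) enumeration
  open HeffterDefs F
  open import Data.Nat.Divisibility using (divides; n∣m*n; m∣m*n; ∣m⇒∣m*n; n∣m*n*o)

  α-with-order : ∃[ α ] HasOrder α m
  α-with-order = ∃-order m (n∣m*n*o 2 n)

  β-with-order : ∃[ β ] HasOrder β n
  β-with-order = ∃-order n (divides (2 ℕ.* m) refl)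

  α β : Carrier
  α = proj₁ α-with-order
  β = proj₁ β-with-order

  α-order : HasOrder α m
  α-order = proj₂ α-with-order

  β-order : HasOrder β n
  β-order = proj₂ β-with-order

  α≢0 : α ≢ 0#
  α≢0 = HasOrder⇒≢0 (ℕₚ.<-trans (s≤s z≤n) 1<m) α-order
  β≢0 : β ≢ 0#
  β≢0 = HasOrder⇒≢0 (ℕₚ.<-trans (s≤s z≤n) 1<n) β-order

  A : Fin m → Fin n → Carrier
  A i j = α ^ Fin.toℕ i * β ^ Fin.toℕ j

  A-≢0 : ∀ i j → A i j ≢ 0#
  A-≢0 i j = *-≢0 (^-≢0 (Fin.toℕ i) α≢0) (^-≢0 (Fin.toℕ j) β≢0)

  rows-sum-to-0 : ∀ i → sumF n (A i) ≡ 0#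
  rows-sum-to-0 i = begin
    sumF n (A i)                   ≡⟨ sumF-*ˡ (α ^ Fin.toℕ i) n (λ j → β ^ Fin.toℕ j) ⟩
    α ^ Fin.toℕ i * geometric β n  ≡⟨ cong (α ^ Fin.toℕ i *_) (geometric≡0 n (^order≡1 β-order) β≢1) ⟩
    α ^ Fin.toℕ i * 0#             ≡⟨ zeroʳ _ ⟩
    0#                             ∎
    where
    open ≡-Reasoning
    β≢1 : β ≢ 1#
    β≢1 = HasOrder⇒≢1 1<n β-order

  columns-sum-to-0 : ∀ j → sumF m (λ i → A i j) ≡ 0#
  columns-sum-to-0 j = begin
    sumF m (λ i → A i j)           ≡⟨ sumF-*ʳ (β ^ Fin.toℕ j) m (λ i → α ^ Fin.toℕ i) ⟩
    geometric α m * β ^ Fin.toℕ j  ≡⟨ cong (_* β ^ Fin.toℕ j) (geometric≡0 m (^order≡1 α-order) α≢1) ⟩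
    0# * β ^ Fin.toℕ j             ≡⟨ zeroˡ _ ⟩
    0#                             ∎
    where
    open ≡-Reasoning
    α≢1 : α ≢ 1#
    α≢1 = HasOrder⇒≢1 1<m α-order

  A-globally-simple : IsGloballySimple A
  A-globally-simple =
      (λ i → psum-geometric-injective β-order (^-≢0 (Fin.toℕ i) α≢0) (A i) (λ _ → refl))
    , (λ j → psum-geometric-injective α-order (^-≢0 (Fin.toℕ j) β≢0) (λ i → A i j) (λ _ → *-comm _ _))

  γ-order : HasOrder (α ^ n) m
  γ-order = HasOrder-^-coprime m⊥n α-order

  A^n : ∀ i j → A i j ^ n ≡ (α ^ n) ^ Fin.toℕ i
  A^n i j = begin
    (α ^ a * β ^ b) ^ n        ≡⟨ ^-distrib-* (α ^ a) (β ^ b) n ⟩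
    (α ^ a) ^ n * (β ^ b) ^ n  ≡⟨ cong₂ _*_ (^-assocʳ α a n) (trans (^-assocʳ β b n) (HasOrder⇒^≡1 β-order (n∣m*n b))) ⟩
    α ^ (a ℕ.* n) * 1#         ≡⟨ *-identityʳ _ ⟩
    α ^ (a ℕ.* n)              ≡⟨ cong (α ^_) (ℕₚ.*-comm a n) ⟩
    α ^ (n ℕ.* a)              ≡⟨ ^-assocʳ α n a ⟨
    (α ^ n) ^ a                ∎
    where
    open ≡-Reasoning
    a = Fin.toℕ i
    b = Fin.toℕ j

  A-injective : ∀ i j i′ j′ → A i j ≡ A i′ j′ → i ≡ i′ × j ≡ j′
  A-injective i j i′ j′ Aᵢⱼ≡Aᵢ′ⱼ′ = i≡i′ , j≡j′
    where
    i≡i′ : i ≡ i′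
    i≡i′ = FinP.toℕ-injective (^-injective γ-order (FinP.toℕ<n i) (FinP.toℕ<n i′)
             (trans (sym (A^n i j)) (trans (cong (_^ n) Aᵢⱼ≡Aᵢ′ⱼ′) (A^n i′ j′))))
    j≡j′ : j ≡ j′
    j≡j′ = FinP.toℕ-injective (^-injective β-order (FinP.toℕ<n j) (FinP.toℕ<n j′)
             (*-cancelˡ (^-≢0 (Fin.toℕ i) α≢0) (trans Aᵢⱼ≡Aᵢ′ⱼ′ (cong (λ k → A k j′) (sym i≡i′)))))

  A^[n*m]≡1 : ∀ i j → A i j ^ (n ℕ.* m) ≡ 1#
  A^[n*m]≡1 i j = begin
    A i j ^ (n ℕ.* m)            ≡⟨ ^-assocʳ (A i j) n m ⟨
    (A i j ^ n) ^ m              ≡⟨ cong (_^ m) (A^n i j) ⟩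
    ((α ^ n) ^ Fin.toℕ i) ^ m    ≡⟨ ^-assocʳ (α ^ n) (Fin.toℕ i) m ⟩
    (α ^ n) ^ (Fin.toℕ i ℕ.* m)  ≡⟨ HasOrder⇒^≡1 γ-order (n∣m*n (Fin.toℕ i)) ⟩
    1#                           ∎
    where open ≡-Reasoning

  A≢-A : ∀ i j i′ j′ → A i j ≢ - A i′ j′
  A≢-A i j i′ j′ Aᵢⱼ≡-Aᵢ′ⱼ′ = 2∣N⇒1+1≢0 (∣m⇒∣m*n n (m∣m*n m)) (begin
    1# + 1#     ≡⟨ cong (1# +_) 1≡-1 ⟩
    1# + - 1#   ≡⟨ -‿inverseʳ 1# ⟩
    0#          ∎)
    where
    open ≡-Reasoning
    1≡-1 : 1# ≡ - 1#
    1≡-1 = begin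
      1#                       ≡⟨ A^[n*m]≡1 i j ⟨
      A i j ^ (n ℕ.* m)        ≡⟨ cong (_^ (n ℕ.* m)) Aᵢⱼ≡-Aᵢ′ⱼ′ ⟩
      (- A i′ j′) ^ (n ℕ.* m)  ≡⟨ -‿^-odd (A i′ j′) (odd-* n-odd m-odd) ⟩
      - (A i′ j′ ^ (n ℕ.* m))  ≡⟨ cong -_ (A^[n*m]≡1 i′ j′) ⟩
      - 1#                     ∎

  ±A : Fin 2 × Fin m × Fin n → Carrier
  ±A (zero     , i , j) = A i j
  ±A (suc zero , i , j) = - A i j

  ±A-≢0 : ∀ sij → ±A sij ≢ 0#
  ±A-≢0 (zero     , i , j) = A-≢0 i j
  ±A-≢0 (suc zero , i , j) = -‿≢0 (A-≢0 i j)

  ±A-injective : Injective _≡_ _≡_ ±A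
  ±A-injective {zero     , i , j} {zero     , i′ , j′} eq with refl , refl ← A-injective i j i′ j′ eq = refl
  ±A-injective {suc zero , i , j} {suc zero , i′ , j′} eq
    with refl , refl ← A-injective i j i′ j′ (-‿injective eq) = refl
  ±A-injective {zero     , i , j} {suc zero , i′ , j′} eq = ⊥-elim (A≢-A i j i′ j′ eq)
  ±A-injective {suc zero , i , j} {zero     , i′ , j′} eq = ⊥-elim (A≢-A i′ j′ i j (sym eq))

  ±A≡⇒A≡± : ∀ {x} sij → ±A sij ≡ x → ∃[ i ] ∃[ j ] (A i j ≡ x ⊎ A i j ≡ - x)
  ±A≡⇒A≡± (zero     , i , j) eq = i , j , inj₁ eq
  ±A≡⇒A≡± (suc zero , i , j) eq = i , j , inj₂ (trans (sym (-‿involutive _)) (cong -_ eq))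

  decode : Fin (2 ℕ.* m ℕ.* n) → Fin 2 × Fin m × Fin n
  decode k = let si , j = Fin.remQuot n k ; s , i = Fin.remQuot m si in s , i , j

  decode-injective : Injective _≡_ _≡_ decode
  decode-injective {k} {k′} eq =
    remQuot-injective n (cong₂ _,_ (remQuot-injective m (cong₂ _,_ (cong proj₁ eq) (cong (proj₁ ∘ proj₂) eq)))
                                   (cong (proj₂ ∘ proj₂) eq))
    where
    remQuot-injective : ∀ {a} b → Injective _≡_ _≡_ (Fin.remQuot {a} b)
    remQuot-injective b = Injection.injective (↔⇒↣ FinP.*↔×)

  entries-form-half-set : EntriesFormHalfSet A
  entries-form-half-set = A-injective , A-≢0 , λ x x≢0 →
    uncurry (λ k → ±A≡⇒A≡± (decode k))
      (nonzero-cover (±A ∘ decode) (±A-≢0 ∘ decode) (decode-injective ∘ ±A-injective) x x≢0)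

  heffter-array : ∃[ A ] (IsHeffter A × IsGloballySimple A)
  heffter-array = A , (entries-form-half-set , rows-sum-to-0 , columns-sum-to-0) , A-globally-simple

open import Data.Nat using (_+_; _*_)

theorem1 : (m n : ℕ) → 3 ≤ m → 3 ≤ n → Odd m → Odd n → Coprime m n
    → IsPrimePower (2 * m * n + 1)
    → (F : Field) → (Field.Carrier F ↔ Fin (2 * m * n + 1))
    → ∃[ A ] (HeffterDefs.IsHeffter F {m} {n} A × HeffterDefs.IsGloballySimple F {m} {n} A)
theorem1 m n 3≤m 3≤n m-odd n-odd m⊥n _ F enumeration =
  Construction.heffter-array F m n enumeration′ (ℕₚ.<⇒≤ 3≤m) (ℕₚ.<⇒≤ 3≤n) m-odd n-odd m⊥n
  where
  enumeration′ : Field.Carrier F ↔ Fin (suc (2 * m * n))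
  enumeration′ = subst (λ q → Field.Carrier F ↔ Fin q) (ℕₚ.+-comm (2 * m * n) 1) enumeration
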